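{- Let $X$ be a finite non-empty set and $P\in\mathfrak{P}(X)$ be disconnected. Then $P$ is not $\mathfrak{U}$-shielded if and only if $P$ has exactly two connectivity components and each of them (as an induced subposet) has an FPP-graph.
   Context: $\mathfrak{P}(X)$ is the set of all posets with carrier $X$, ordered by $P\sqsubseteq Q$ iff $\leq_P\subseteq\leq_Q$; $\mathfrak{U}(P)$ is the set of upper covers of $P$ in $(\mathfrak{P}(X),\sqsubseteq)$. For a poset $P$: $[x,y]_P=\{z: x\leq_P z\leq_P y\}$; $L(P)$, $U(P)$ are the sets of minimal and maximal elements, $M(P)$ the remaining elements; $\prec_P=\{(a,b)\in<_P: M(P)\cap[a,b]_P=\emptyset\}$. $P\setminus(a,b)=(X,\leq_P\setminus\{(a,b)\})$. $P$ is connected iff its comparability graph is connected; connectivity components are the maximal connected subsets, identified with their induced subposets. $P$ has an FPP-graph iff $P$ is connected and $P\setminus(a,b)$ is disconnected for every $(a,b)\in\prec_P$. $P$ is $\mathfrak{U}$-shielded iff no poset in $\mathfrak{U}(P)$ has an FPP-graph. -}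

module Defs where

open import Data.Nat using (ℕ; suc)
open import Data.Fin using (Fin)
open import Data.Bool using (Bool; true)
open import Data.Unit using (⊤)
open import Data.Product using (_×_; Σ; ∃; ∃-syntax; _,_)
open import Data.Sum using (_⊎_)
open import Relation.Nullary using (¬_)
open import Relation.Binary.PropositionalEquality using (_≡_; _≢_)
open import Relation.Binary.Construct.Closure.ReflexiveTransitive using (Star)

-- A (candidate) order relation on the carrier X = Fin n, as a Boolean matrix:
-- x ≤ y  iff  R x y ≡ true.
BRel : ℕ → Set
BRel n = Fin n → Fin n → Bool

module _ {n : ℕ} where

  _⊢_≤_ : BRel n → Fin n → Fin n → Set
  P ⊢ x ≤ y = P x y ≡ true

  _⊢_<_ : BRel n → Fin n → Fin n → Set
  P ⊢ x < y = (P ⊢ x ≤ y) × (x ≢ y)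

  record IsPoset (P : BRel n) : Set where
    field
      refl  : ∀ x → P ⊢ x ≤ x
      antisym : ∀ x y → P ⊢ x ≤ y → P ⊢ y ≤ x → x ≡ y
      trans : ∀ x y z → P ⊢ x ≤ y → P ⊢ y ≤ z → P ⊢ x ≤ z

  _⊑_ : BRel n → BRel n → Set
  P ⊑ Q = ∀ x y → P ⊢ x ≤ y → Q ⊢ x ≤ y

  _⊏_ : BRel n → BRel n → Set
  P ⊏ Q = (P ⊑ Q) × (∃[ x ] ∃[ y ] ((Q ⊢ x ≤ y) × ¬ (P ⊢ x ≤ y)))

  UpperCover : BRel n → BRel n → Set
  UpperCover P Q =
    IsPoset Q × (P ⊏ Q) × ¬ (∃[ R ] (IsPoset R × (P ⊏ R) × (R ⊏ Q)))

  -- Notions for the subposet induced on a subset S ⊆ X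
  -- (S given as a predicate; the whole poset is S = λ _ → ⊤).

  Subset : Set₁
  Subset = Fin n → Set

  Full : Subset
  Full _ = ⊤

  IsMin : BRel n → Subset → Fin n → Set
  IsMin P S x = S x × (∀ y → S y → P ⊢ y ≤ x → y ≡ x)

  IsMax : BRel n → Subset → Fin n → Set
  IsMax P S x = S x × (∀ y → S y → P ⊢ x ≤ y → y ≡ x)

  IsMid : BRel n → Subset → Fin n → Set
  IsMid P S x = S x × ¬ IsMin P S x × ¬ IsMax P S x

  Cov : BRel n → Subset → Fin n → Fin n → Set
  Cov P S a b =
    S a × S b × (P ⊢ a < b) ×
    (∀ z → S z → P ⊢ a ≤ z → P ⊢ z ≤ b → ¬ IsMid P S z)

  Comp : (Fin n → Fin n → Set) → Subset → Fin n → Fin n → Set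
  Comp R S x y = S x × S y × (R x y ⊎ R y x)

  ConnectedOn : (Fin n → Fin n → Set) → Subset → Set
  ConnectedOn R S = ∀ x y → S x → S y → Star (Comp R S) x y

  Le : BRel n → Fin n → Fin n → Set
  Le P x y = P ⊢ x ≤ y

  Remove : BRel n → Fin n → Fin n → Fin n → Fin n → Set
  Remove P a b x y = (P ⊢ x ≤ y) × ¬ ((x ≡ a) × (y ≡ b))

  HasFPPOn : BRel n → Subset → Set
  HasFPPOn P S =
    ConnectedOn (Le P) S ×
    (∀ a b → Cov P S a b → ¬ ConnectedOn (Remove P a b) S)

  Connected : BRel n → Set
  Connected P = ConnectedOn (Le P) Full

  HasFPP : BRel n → Set
  HasFPP P = HasFPPOn P Full

  UShielded : BRel n → Set
  UShielded P = ∀ Q → UpperCover P Q → ¬ HasFPP Q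

  SameComp : BRel n → Fin n → Fin n → Set
  SameComp P = Star (Comp (Le P) Full)

  Component : BRel n → Fin n → Subset
  Component P a = SameComp P a

  TwoComponentsFPP : BRel n → Set
  TwoComponentsFPP P =
    ∃[ a ] ∃[ b ]
      (¬ SameComp P a b ×
       (∀ x → SameComp P a x ⊎ SameComp P b x) ×
       HasFPPOn P (Component P a) ×
       HasFPPOn P (Component P b))

-- An upper cover Q of P adds a single relation c < d. If P is disconnected and Q connected,
-- c and d lie in different components, which are then the only two, and minimality of the
-- cover forces c to be minimal and d maximal in P. For such a Q, removing (c , d) leaves the
-- disconnected P, while every other covering pair of Q is a covering pair of the component of
-- P containing it, and removing it disconnects Q exactly when it disconnects that component.

module Submission where

open import Defs
open import Data.Nat using (ℕ; suc)
open import Data.Fin using (Fin; zero)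
open import Data.Fin.Properties using (any?) renaming (_≟_ to _≟ᶠ_)
open import Data.Fin.Subset as FinSubset using (_∈_; _∪_; ⁅_⁆; _⊃_)
open import Data.Fin.Subset.Properties using (_∈?_; p⊆p∪q; x∈p∪q⁺; x∈p∪q⁻; x∈⁅x⁆; x∈⁅y⁆⇒x≡y)
open import Data.Fin.Subset.Induction using (⊃-wellFounded)
open import Data.Fin.Induction using (po-wellFounded)
open import Data.Bool using (true; false; _∨_; _∧_)
open import Data.Bool.Properties using (∨-zeroʳ) renaming (_≟_ to _≟ᵇ_)
open import Data.Product using (∃; _×_; _,_; proj₁; proj₂)
open import Data.Sum as Sum using (_⊎_; inj₁; inj₂; [_,_]; [_,_]′)
open import Data.Empty using (⊥; ⊥-elim)
open import Data.Unit using (tt)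
open import Function using (id; flip; const; _∘_)
open import Function.Bundles using (_⇔_; mk⇔)
open import Induction.WellFounded using (Acc; acc)
open import Relation.Nullary using (¬_; Dec; yes; no)
open import Relation.Nullary.Decidable using (_×-dec_; _⊎-dec_; ¬?; map′; decidable-stable)
open import Relation.Binary using (Rel; Decidable; IsPartialOrder)
open import Relation.Binary.PropositionalEquality
  using (_≡_; refl; sym; subst; subst₂; isEquivalence)
open import Relation.Binary.Construct.Closure.ReflexiveTransitive
  using (Star; ε; _◅_; _◅◅_; return; map; reverse; kleisliStar)

private
  variable
    m : ℕ
    P Q R : BRel m
    e f r x y z : Fin m

module _ {ℓ} {R : Rel (Fin m) ℓ} (R? : Decidable R) where

  private
    Closed : FinSubset.Subset m → Set ℓ
    Closed S = ∀ {z y} → z ∈ S → R z y → y ∈ S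

    closed-Star : ∀ {S} → Closed S → z ∈ S → Star R z y → y ∈ S
    closed-Star closed z∈S ε = z∈S
    closed-Star closed z∈S (Rzw ◅ path) = closed-Star closed (closed z∈S Rzw) path

    reachable-closure : ∀ x S → Acc _⊃_ S → x ∈ S → (∀ {z} → z ∈ S → Star R x z) →
                        ∃ λ T → x ∈ T × (∀ {z} → z ∈ T → Star R x z) × Closed T
    reachable-closure x S (acc rec) x∈S reach
      with any? (λ z → any? (λ y → (z ∈? S) ×-dec R? z y ×-dec ¬? (y ∈? S)))
    ... | no none = S , x∈S , reach , closed
      where
        closed : Closed S
        closed {z} {y} z∈S Rzy = decidable-stable (y ∈? S) (λ y∉S → none (z , y , z∈S , Rzy , y∉S))
    ... | yes (z , y , z∈S , Rzy , y∉S) =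
      reachable-closure x (S ∪ ⁅ y ⁆) (rec S⊂S∪y) (p⊆p∪q _ x∈S) reach′
      where
        S⊂S∪y : (S ∪ ⁅ y ⁆) ⊃ S
        S⊂S∪y = p⊆p∪q _ , y , x∈p∪q⁺ (inj₂ (x∈⁅x⁆ y)) , y∉S

        reach′ : ∀ {w} → w ∈ S ∪ ⁅ y ⁆ → Star R x w
        reach′ w∈ with x∈p∪q⁻ S ⁅ y ⁆ w∈
        ... | inj₁ w∈S = reach w∈S
        ... | inj₂ w∈y = subst (Star R x) (sym (x∈⁅y⁆⇒x≡y y w∈y)) (reach z∈S ◅◅ return Rzy)

  Star? : Decidable (Star R)
  Star? x y with reachable-closure x ⁅ x ⁆ (⊃-wellFounded _) (x∈⁅x⁆ x) reach-x
    where
      reach-x : ∀ {z} → z ∈ ⁅ x ⁆ → Star R x z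
      reach-x z∈ = subst (Star R x) (sym (x∈⁅y⁆⇒x≡y x z∈)) ε
  ... | T , x∈T , reach , closed = map′ reach (closed-Star closed x∈T) (y ∈? T)

isPartialOrder : IsPoset P → IsPartialOrder _≡_ (Le P)
isPartialOrder {P = P} isP = record
  { isPreorder = record
    { isEquivalence = isEquivalence
    ; reflexive = λ { {x} refl → IsPoset.refl isP x }
    ; trans = λ {x} {y} {z} → IsPoset.trans isP x y z }
  ; antisym = λ {x} {y} → IsPoset.antisym isP x y }

minimal-below : IsPoset P → ∀ x → ∃ λ c → P ⊢ c ≤ x × (∀ y → P ⊢ y ≤ c → y ≡ c)
minimal-below {P = P} isP x = go x (po-wellFounded (isPartialOrder isP) x)
  where
    go : ∀ x → Acc (P ⊢_<_) x → ∃ λ c → P ⊢ c ≤ x × (∀ y → P ⊢ y ≤ c → y ≡ c)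
    go x (acc rec) with any? (λ y → (P y x ≟ᵇ true) ×-dec ¬? (y ≟ᶠ x))
    ... | no none =
      x , IsPoset.refl isP x , λ y y≤x → decidable-stable (y ≟ᶠ x) (λ y≢x → none (y , y≤x , y≢x))
    ... | yes (y , y<x) with go y (rec y<x)
    ...   | c , c≤y , c-minimal = c , IsPoset.trans isP c y x c≤y (proj₁ y<x) , c-minimal

dual-isPoset : IsPoset P → IsPoset (flip P)
dual-isPoset isP = record
  { refl = IsPoset.refl isP
  ; antisym = λ x y y≤x x≤y → IsPoset.antisym isP x y x≤y y≤x
  ; trans = λ x y z y≤x z≤y → IsPoset.trans isP z y x z≤y y≤x }

dual-⊏ : P ⊏ Q → flip P ⊏ flip Q
dual-⊏ (P⊑Q , x , y , y≤Qx , y≰Px) = (λ x y → P⊑Q y x) , y , x , y≤Qx , y≰Px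

dual-upperCover : UpperCover P Q → UpperCover (flip P) (flip Q)
dual-upperCover (isQ , P⊏Q , no-between) =
  dual-isPoset isQ , dual-⊏ P⊏Q ,
  λ (R , isR , P⊏R , R⊏Q) → no-between (flip R , dual-isPoset isR , dual-⊏ P⊏R , dual-⊏ R⊏Q)

Comp-sym : ∀ {R : Fin m → Fin m → Set} {S : Subset} → Comp R S x y → Comp R S y x
Comp-sym (Sx , Sy , Rxy⊎Ryx) = Sy , Sx , Sum.swap Rxy⊎Ryx

Comp-map : ∀ {R R′ : Fin m → Fin m → Set} {S S′ : Subset} →
           (∀ {x y} → S x → S y → R x y → R′ x y) → (∀ {x} → S x → S′ x) →
           Comp R S x y → Comp R′ S′ x y
Comp-map f g (Sx , Sy , inj₁ Rxy) = g Sx , g Sy , inj₁ (f Sx Sy Rxy)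
Comp-map f g (Sx , Sy , inj₂ Ryx) = g Sx , g Sy , inj₂ (f Sy Sx Ryx)

infix 4 _⊢_∼_

_⊢_∼_ : BRel m → Fin m → Fin m → Set
P ⊢ x ∼ y = SameComp P x y

∼-sym : P ⊢ x ∼ y → P ⊢ y ∼ x
∼-sym {P = P} = reverse (Comp-sym {R = Le P} {S = Full})

≤⇒∼ : P ⊢ x ≤ y → P ⊢ x ∼ y
≤⇒∼ x≤y = return (tt , tt , inj₁ x≤y)

≥⇒∼ : P ⊢ y ≤ x → P ⊢ x ∼ y
≥⇒∼ y≤x = return (tt , tt , inj₂ y≤x)

infix 4 _⊢_∼?_

_⊢_∼?_ : ∀ (P : BRel m) → Decidable (P ⊢_∼_)
_⊢_∼?_ P = Star? λ x y → map′ (λ h → tt , tt , h) (proj₂ ∘ proj₂)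
                               ((P x y ≟ᵇ true) ⊎-dec (P y x ≟ᵇ true))

∼-everywhere⇒Connected : ∀ {a} → (∀ x → P ⊢ a ∼ x) → Connected P
∼-everywhere⇒Connected a∼ x y _ _ = ∼-sym (a∼ x) ◅◅ a∼ y

separated-from : ¬ Connected P → ∀ a → ∃ λ b → ¬ P ⊢ a ∼ b
separated-from {P = P} disc a with any? (λ b → ¬? (P ⊢ a ∼? b))
... | yes found = found
... | no none = ⊥-elim (disc (∼-everywhere⇒Connected λ x →
  decidable-stable (P ⊢ a ∼? x) (λ a≁x → none (x , a≁x))))

path-in-component : P ⊢ r ∼ x → P ⊢ x ∼ y → Star (Comp (Le P) (Component P r)) x y
path-in-component r∼x ε = ε
path-in-component r∼x (edge@(_ , _ , x≤y⊎y≤x) ◅ path) =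
  (r∼x , r∼x ◅◅ return edge , x≤y⊎y≤x) ◅ path-in-component (r∼x ◅◅ return edge) path

component-connected : ∀ r → ConnectedOn (Le P) (Component P r)
component-connected r x y r∼x r∼y = path-in-component r∼x (∼-sym r∼x ◅◅ r∼y)

no-three-components : ∀ {a b c d} → (∀ x → P ⊢ c ∼ x ⊎ P ⊢ d ∼ x) →
                      ¬ P ⊢ a ∼ b → ¬ P ⊢ a ∼ x → ¬ P ⊢ b ∼ x → ⊥
no-three-components {x = x} {a = a} {b = b} c∼⊎d∼ a≁b a≁x b≁x with c∼⊎d∼ a | c∼⊎d∼ b | c∼⊎d∼ x
... | inj₁ c∼a | inj₁ c∼b | _ = a≁b (∼-sym c∼a ◅◅ c∼b)
... | inj₂ d∼a | inj₂ d∼b | _ = a≁b (∼-sym d∼a ◅◅ d∼b)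
... | inj₁ c∼a | _ | inj₁ c∼x = a≁x (∼-sym c∼a ◅◅ c∼x)
... | inj₂ d∼a | _ | inj₂ d∼x = a≁x (∼-sym d∼a ◅◅ d∼x)
... | _ | inj₁ c∼b | inj₁ c∼x = b≁x (∼-sym c∼b ◅◅ c∼x)
... | _ | inj₂ d∼b | inj₂ d∼x = b≁x (∼-sym d∼b ◅◅ d∼x)

module _ (P : BRel m) (c d : Fin m) where

  adjoin : BRel m
  adjoin x y = P x y ∨ (P x c ∧ P d y)

  adjoin⁻ : adjoin ⊢ x ≤ y → P ⊢ x ≤ y ⊎ (P ⊢ x ≤ c × P ⊢ d ≤ y)
  adjoin⁻ {x = x} {y = y} x≤y with P x y | P x c | P d y
  ... | true  | _     | _     = inj₁ refl
  ... | false | true  | true  = inj₂ (refl , refl)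
  adjoin⁻ () | false | true  | false
  adjoin⁻ () | false | false | _

  ⊑-adjoin : P ⊑ adjoin
  ⊑-adjoin x y x≤y rewrite x≤y = refl

  adjoin⁺ : P ⊢ x ≤ c → P ⊢ d ≤ y → adjoin ⊢ x ≤ y
  adjoin⁺ {x = x} x≤c d≤y rewrite x≤c | d≤y = ∨-zeroʳ (P x _)

  adjoin-only : (∀ y → P ⊢ y ≤ c → y ≡ c) → (∀ y → P ⊢ d ≤ y → y ≡ d) →
                adjoin ⊢ x ≤ y → P ⊢ x ≤ y ⊎ (x ≡ c × y ≡ d)
  adjoin-only c-minimal d-maximal x≤y =
    Sum.map₂ (λ (x≤c , d≤y) → c-minimal _ x≤c , d-maximal _ d≤y) (adjoin⁻ x≤y)

  adjoin-least : IsPoset Q → P ⊑ Q → Q ⊢ c ≤ d → adjoin ⊑ Q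
  adjoin-least isQ P⊑Q c≤d x y x≤y with adjoin⁻ x≤y
  ... | inj₁ x≤Py = P⊑Q x y x≤Py
  ... | inj₂ (x≤c , d≤y) = ≤Q-trans x c y (P⊑Q x c x≤c) (≤Q-trans c d y c≤d (P⊑Q d y d≤y))
    where open IsPoset isQ renaming (trans to ≤Q-trans)

  module _ (isP : IsPoset P) where
    open IsPoset isP renaming (refl to ≤-refl; antisym to ≤-antisym; trans to ≤-trans)

    adjoin-c≤d : adjoin ⊢ c ≤ d
    adjoin-c≤d = adjoin⁺ (≤-refl c) (≤-refl d)

    ⊏-adjoin : ¬ P ⊢ c ≤ d → P ⊏ adjoin
    ⊏-adjoin c≰d = ⊑-adjoin , c , d , adjoin-c≤d , c≰d

    adjoin-isPoset : ¬ P ⊢ d ≤ c → IsPoset adjoin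
    adjoin-isPoset d≰c = record
      { refl = λ x → ⊑-adjoin x x (≤-refl x)
      ; antisym = adjoin-antisym
      ; trans = adjoin-trans }
      where
        adjoin-antisym : ∀ x y → adjoin ⊢ x ≤ y → adjoin ⊢ y ≤ x → x ≡ y
        adjoin-antisym x y x≤y y≤x with adjoin⁻ x≤y | adjoin⁻ y≤x
        ... | inj₁ x≤y | inj₁ y≤x = ≤-antisym x y x≤y y≤x
        ... | inj₁ x≤y | inj₂ (y≤c , d≤x) = ⊥-elim (d≰c (≤-trans d x c d≤x (≤-trans x y c x≤y y≤c)))
        ... | inj₂ (x≤c , d≤y) | inj₁ y≤x = ⊥-elim (d≰c (≤-trans d y c d≤y (≤-trans y x c y≤x x≤c)))
        ... | inj₂ (x≤c , _) | inj₂ (_ , d≤x) = ⊥-elim (d≰c (≤-trans d x c d≤x x≤c))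

        adjoin-trans : ∀ x y z → adjoin ⊢ x ≤ y → adjoin ⊢ y ≤ z → adjoin ⊢ x ≤ z
        adjoin-trans x y z x≤y y≤z with adjoin⁻ x≤y | adjoin⁻ y≤z
        ... | inj₁ x≤y | inj₁ y≤z = ⊑-adjoin x z (≤-trans x y z x≤y y≤z)
        ... | inj₁ x≤y | inj₂ (y≤c , d≤z) = adjoin⁺ (≤-trans x y c x≤y y≤c) d≤z
        ... | inj₂ (x≤c , d≤y) | inj₁ y≤z = adjoin⁺ x≤c (≤-trans d y z d≤y y≤z)
        ... | inj₂ (_ , d≤y) | inj₂ (y≤c , _) = ⊥-elim (d≰c (≤-trans d y c d≤y y≤c))

upperCover-squeeze : UpperCover P Q → IsPoset R → P ⊏ R → R ⊑ Q → Q ⊑ R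
upperCover-squeeze {R = R} (_ , _ , no-between) isR P⊏R R⊑Q x y x≤Qy =
  decidable-stable (R x y ≟ᵇ true) (λ x≰Ry → no-between (R , isR , P⊏R , R⊑Q , x , y , x≤Qy , x≰Ry))

single-pair⇒upperCover : ∀ {c d} → IsPoset Q → P ⊑ Q → Q ⊢ c ≤ d → ¬ P ⊢ c ≤ d →
                         (∀ x y → Q ⊢ x ≤ y → P ⊢ x ≤ y ⊎ (x ≡ c × y ≡ d)) → UpperCover P Q
single-pair⇒upperCover {Q = Q} {P = P} isQ P⊑Q c≤d c≰d only-c≤d =
  isQ , (P⊑Q , _ , _ , c≤d , c≰d) , no-between
  where
    no-between : ¬ ∃ λ R → IsPoset R × P ⊏ R × R ⊏ Q
    no-between (R , _ , (P⊑R , x , y , x≤Ry , x≰Py) , (R⊑Q , x′ , y′ , x′≤Qy′ , x′≰Ry′))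
      with only-c≤d x y (R⊑Q x y x≤Ry) | only-c≤d x′ y′ x′≤Qy′
    ... | inj₁ x≤Py | _ = x≰Py x≤Py
    ... | _ | inj₁ x′≤Py′ = x′≰Ry′ (P⊑R x′ y′ x′≤Py′)
    ... | inj₂ (refl , refl) | inj₂ (refl , refl) = x′≰Ry′ x≤Ry

new-pair-not-reversed : ∀ {c d} → IsPoset P → IsPoset Q → P ⊑ Q →
                        Q ⊢ c ≤ d → ¬ P ⊢ c ≤ d → ¬ P ⊢ d ≤ c
new-pair-not-reversed {P = P} {c = c} {d = d} isP isQ P⊑Q c≤d c≰d d≤c =
  c≰d (subst (P ⊢ c ≤_) (IsPoset.antisym isQ c d c≤d (P⊑Q d c d≤c)) (IsPoset.refl isP c))

upperCover-minimal : ∀ {c d} → IsPoset P → UpperCover P Q → Q ⊢ c ≤ d → ¬ P ⊢ c ≤ d →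
                     (∀ y → P ⊢ y ≤ c → ¬ P ⊢ y ≤ d) → ∀ y → P ⊢ y ≤ c → y ≡ c
upperCover-minimal {P = P} {Q = Q} {c = c} {d = d}
                   isP cover@(isQ , (P⊑Q , _) , _) c≤d c≰d below-c-not-below-d y y≤c =
  [ ⊥-elim ∘ c≰d , (λ (c≤y , _) → IsPoset.antisym isP y c y≤c c≤y) ]′ (adjoin⁻ P y d c≤Rd)
  where
    d≰y : ¬ P ⊢ d ≤ y
    d≰y d≤y = new-pair-not-reversed isP isQ P⊑Q c≤d c≰d (IsPoset.trans isP d y c d≤y y≤c)

    R-isPoset : IsPoset (adjoin P y d)
    R-isPoset = adjoin-isPoset P y d isP d≰y

    P⊏R : P ⊏ adjoin P y d
    P⊏R = ⊏-adjoin P y d isP (below-c-not-below-d y y≤c)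

    R⊑Q : adjoin P y d ⊑ Q
    R⊑Q = adjoin-least P y d isQ P⊑Q (IsPoset.trans isQ y c d (P⊑Q y c y≤c) c≤d)

    -- otherwise adjoin P y d would lie strictly between P and Q
    c≤Rd : adjoin P y d ⊢ c ≤ d
    c≤Rd = upperCover-squeeze cover R-isPoset P⊏R R⊑Q c d c≤d

-- The shape of every connected upper cover Q of a disconnected poset P: Q adds the single
-- relation c < d from a minimal to a maximal element, and c, d lie in the only two components.
record Bridge (P Q : BRel m) : Set where
  field
    c d       : Fin m
    P⊑Q       : P ⊑ Q
    c≤d       : Q ⊢ c ≤ d
    only-c≤d  : ∀ x y → Q ⊢ x ≤ y → P ⊢ x ≤ y ⊎ (x ≡ c × y ≡ d)
    c≁d       : ¬ P ⊢ c ∼ d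
    c∼⊎d∼     : ∀ x → P ⊢ c ∼ x ⊎ P ⊢ d ∼ x
    c-minimal : ∀ y → P ⊢ y ≤ c → y ≡ c
    d-maximal : ∀ y → P ⊢ d ≤ y → y ≡ d

IsMid-⊑ : ∀ {S : Subset} → P ⊑ Q → IsMid P S z → IsMid Q Full z
IsMid-⊑ {z = z} P⊑Q (Sz , not-min , not-max) =
  tt , (λ (_ , min) → not-min (Sz , λ y _ y≤z → min y tt (P⊑Q y z y≤z)))
     , (λ (_ , max) → not-max (Sz , λ y _ z≤y → max y tt (P⊑Q z y z≤y)))

module BridgeProperties {P Q : BRel m} (B : Bridge P Q) where
  open Bridge B

  c≰d : ¬ P ⊢ c ≤ d
  c≰d = c≁d ∘ ≤⇒∼

  c-minimal-in-Q : IsMin Q Full c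
  c-minimal-in-Q = tt , λ y _ y≤c → [ c-minimal y , proj₁ ] (only-c≤d y c y≤c)

  d-maximal-in-Q : IsMax Q Full d
  d-maximal-in-Q = tt , λ y _ d≤y → [ d-maximal y , proj₂ ] (only-c≤d d y d≤y)

  upperCover : IsPoset Q → UpperCover P Q
  upperCover isQ = single-pair⇒upperCover isQ P⊑Q c≤d c≰d only-c≤d

  connected-via-bridge : ∀ {R : Fin m → Fin m → Set} →
                         (∀ {x y} → P ⊢ x ∼ y → Star (Comp R Full) x y) → R c d → ConnectedOn R Full
  connected-via-bridge {R = R} lift Rcd x y _ _ =
    to-c x ◅◅ reverse (Comp-sym {R = R} {S = Full}) (to-c y)
    where
      to-c : ∀ x → Star (Comp R Full) x c
      to-c x with c∼⊎d∼ x
      ... | inj₁ c∼x = lift (∼-sym c∼x)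
      ... | inj₂ d∼x = lift (∼-sym d∼x) ◅◅ return (tt , tt , inj₂ Rcd)

  Q-connected : Connected Q
  Q-connected =
    connected-via-bridge {R = Le Q} (map (Comp-map {R = Le P} {S = Full} (λ _ _ → P⊑Q _ _) id)) c≤d

  bridge-removed⇒Connected : ConnectedOn (Remove Q c d) Full → Connected P
  bridge-removed⇒Connected conn x y _ _ =
    map (Comp-map {R = Remove Q c d} {S = Full} P-edge id) (conn x y tt tt)
    where
      P-edge : ∀ {u v} → Full u → Full v → Remove Q c d u v → Le P u v
      P-edge {u} {v} _ _ (u≤v , not-cd) = [ id , ⊥-elim ∘ not-cd ] (only-c≤d u v u≤v)

  P-interval : P ⊢ e ≤ f → Q ⊢ e ≤ z → Q ⊢ z ≤ f → P ⊢ e ≤ z × P ⊢ z ≤ f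
  P-interval {e = e} {f = f} {z = z} e≤f e≤z z≤f with only-c≤d e z e≤z | only-c≤d z f z≤f
  ... | inj₁ e≤Pz | inj₁ z≤Pf = e≤Pz , z≤Pf
  ... | inj₂ (refl , refl) | _ = ⊥-elim (c≰d (subst (P ⊢ c ≤_) (proj₂ d-maximal-in-Q f tt z≤f) e≤f))
  ... | _ | inj₂ (refl , refl) = ⊥-elim (c≰d (subst (P ⊢_≤ d) (proj₂ c-minimal-in-Q e tt e≤z) e≤f))

  IsMid-component : P ⊢ r ∼ z → IsMid Q Full z → IsMid P (Component P r) z
  IsMid-component {r = r} {z = z} r∼z (_ , not-min , not-max) = r∼z , not-min-P , not-max-P
    where
      not-min-P : ¬ IsMin P (Component P r) z
      not-min-P (_ , min) = not-min (tt , λ y _ y≤z → z-minimal-in-Q (only-c≤d y z y≤z))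
        where
          z-minimal-in-Q : ∀ {y} → P ⊢ y ≤ z ⊎ (y ≡ c × z ≡ d) → y ≡ z
          z-minimal-in-Q (inj₁ y≤z) = min _ (r∼z ◅◅ ≥⇒∼ y≤z) y≤z
          z-minimal-in-Q (inj₂ (_ , z≡d)) =
            ⊥-elim (not-max (subst (IsMax Q Full) (sym z≡d) d-maximal-in-Q))

      not-max-P : ¬ IsMax P (Component P r) z
      not-max-P (_ , max) = not-max (tt , λ y _ z≤y → z-maximal-in-Q (only-c≤d z y z≤y))
        where
          z-maximal-in-Q : ∀ {y} → P ⊢ z ≤ y ⊎ (z ≡ c × y ≡ d) → y ≡ z
          z-maximal-in-Q (inj₁ z≤y) = max _ (r∼z ◅◅ ≤⇒∼ z≤y) z≤y
          z-maximal-in-Q (inj₂ (z≡c , _)) =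
            ⊥-elim (not-min (subst (IsMin Q Full) (sym z≡c) c-minimal-in-Q))

  Cov⁺ : Cov P (Component P r) e f → Cov Q Full e f
  Cov⁺ {e = e} {f = f} (r∼e , _ , (e≤f , e≢f) , no-mid) =
    tt , tt , (P⊑Q e f e≤f , e≢f) , λ z _ e≤z z≤f mid →
      let (e≤Pz , z≤Pf) = P-interval e≤f e≤z z≤f
          r∼z = r∼e ◅◅ ≤⇒∼ e≤Pz
      in no-mid z r∼z e≤Pz z≤Pf (IsMid-component r∼z mid)

  Cov⁻ : P ⊢ r ∼ e → ¬ (e ≡ c × f ≡ d) → Cov Q Full e f → Cov P (Component P r) e f
  Cov⁻ {e = e} {f = f} r∼e not-cd (_ , _ , (e≤f , e≢f) , no-mid) with only-c≤d e f e≤f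
  ... | inj₂ cd = ⊥-elim (not-cd cd)
  ... | inj₁ e≤Pf = r∼e , r∼e ◅◅ ≤⇒∼ e≤Pf , (e≤Pf , e≢f) , λ z _ e≤z z≤f mid →
                      no-mid z tt (P⊑Q e z e≤z) (P⊑Q z f z≤f) (IsMid-⊑ P⊑Q mid)

  -- Collapsing everything outside the component of r onto the end of the bridge inside it
  -- maps paths of Q ∖ (e , f) to paths of P ∖ (e , f) within that component.
  module _ (r e f : Fin m) where
    private
      collapse : Fin m → Fin m
      collapse x with P ⊢ r ∼? x | P ⊢ r ∼? c
      ... | yes _ | _ = x
      ... | no _ | yes _ = c
      ... | no _ | no _ = d

      collapse-inside : P ⊢ r ∼ x → collapse x ≡ x
      collapse-inside {x = x} r∼x with P ⊢ r ∼? x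
      ... | yes _ = refl
      ... | no r≁x = ⊥-elim (r≁x r∼x)

      collapse-outside : ¬ P ⊢ r ∼ x → ¬ P ⊢ r ∼ y → collapse x ≡ collapse y
      collapse-outside {x = x} {y = y} r≁x r≁y with P ⊢ r ∼? x | P ⊢ r ∼? y | P ⊢ r ∼? c
      ... | yes r∼x | _ | _ = ⊥-elim (r≁x r∼x)
      ... | _ | yes r∼y | _ = ⊥-elim (r≁y r∼y)
      ... | no _ | no _ | yes _ = refl
      ... | no _ | no _ | no _ = refl

      collapse-bridge : collapse c ≡ collapse d
      collapse-bridge with P ⊢ r ∼? c | P ⊢ r ∼? d
      ... | yes r∼c | yes r∼d = ⊥-elim (c≁d (∼-sym r∼c ◅◅ r∼d))
      ... | yes _ | no _ = refl
      ... | no _ | yes _ = refl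
      ... | no _ | no _ = refl

      Path : Fin m → Fin m → Set
      Path = Star (Comp (Remove P e f) (Component P r))

      collapse-P-step : P ⊢ x ≤ y → ¬ (x ≡ e × y ≡ f) → Dec (P ⊢ r ∼ x) →
                        Path (collapse x) (collapse y)
      collapse-P-step {y = y} x≤y not-ef (yes r∼x) =
        subst₂ Path (sym (collapse-inside r∼x)) (sym (collapse-inside r∼y))
               (return (r∼x , r∼y , inj₁ (x≤y , not-ef)))
        where
          r∼y : P ⊢ r ∼ y
          r∼y = r∼x ◅◅ ≤⇒∼ x≤y
      collapse-P-step {x = x} x≤y not-ef (no r≁x) =
        subst (Path (collapse x)) (collapse-outside r≁x (λ r∼y → r≁x (r∼y ◅◅ ≥⇒∼ x≤y))) ε

      collapse-step : Remove Q e f x y → Path (collapse x) (collapse y)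
      collapse-step {x = x} {y = y} (x≤y , not-ef) with only-c≤d x y x≤y
      ... | inj₁ x≤Py = collapse-P-step x≤Py not-ef (P ⊢ r ∼? x)
      ... | inj₂ (refl , refl) = subst (Path (collapse c)) collapse-bridge ε

      collapse-edge : Comp (Remove Q e f) Full x y → Path (collapse x) (collapse y)
      collapse-edge (_ , _ , inj₁ xy) = collapse-step xy
      collapse-edge (_ , _ , inj₂ yx) =
        reverse (Comp-sym {R = Remove P e f} {S = Component P r}) (collapse-step yx)

    Remove-connected⁻ : ConnectedOn (Remove Q e f) Full → ConnectedOn (Remove P e f) (Component P r)
    Remove-connected⁻ conn x y r∼x r∼y =
      subst₂ Path (collapse-inside r∼x) (collapse-inside r∼y)
             (kleisliStar collapse collapse-edge (conn x y tt tt))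

  -- Components other than that of r do not contain e, so their edges survive in Q ∖ (e , f).
  Remove-connected⁺ : P ⊢ r ∼ e → P ⊢ e ≤ f → ConnectedOn (Remove P e f) (Component P r) →
                      ConnectedOn (Remove Q e f) Full
  Remove-connected⁺ {r = r} {e = e} {f = f} r∼e e≤f conn =
    connected-via-bridge {R = Remove Q e f} link
      (c≤d , λ (c≡e , d≡f) → c≰d (subst₂ (P ⊢_≤_) (sym c≡e) (sym d≡f) e≤f))
    where
      link : P ⊢ x ∼ y → Star (Comp (Remove Q e f) Full) x y
      link {x = x} {y = y} x∼y with P ⊢ r ∼? x
      ... | yes r∼x =
        map (Comp-map {R = Remove P e f} lift-edge (const tt)) (conn x y r∼x (r∼x ◅◅ x∼y))
        where
          lift-edge : ∀ {u v} → P ⊢ r ∼ u → P ⊢ r ∼ v → Remove P e f u v → Remove Q e f u v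
          lift-edge _ _ (u≤v , not-ef) = P⊑Q _ _ u≤v , not-ef
      ... | no r≁x = map (Comp-map {R = Le P} other-edge (const tt)) (path-in-component ε x∼y)
        where
          other-edge : ∀ {u v} → P ⊢ x ∼ u → P ⊢ x ∼ v → P ⊢ u ≤ v → Remove Q e f u v
          other-edge x∼u _ u≤v =
            P⊑Q _ _ u≤v , λ (u≡e , _) → r≁x (r∼e ◅◅ ∼-sym (subst (P ⊢ x ∼_) u≡e x∼u))

  component-hasFPP : HasFPP Q → ∀ r → HasFPPOn P (Component P r)
  component-hasFPP (_ , Q-fpp) r =
    component-connected r ,
    λ e f cov@(r∼e , _ , (e≤f , _) , _) conn → Q-fpp e f (Cov⁺ cov) (Remove-connected⁺ r∼e e≤f conn)

  hasFPP : ¬ Connected P → (∀ e → ∃ λ r → P ⊢ r ∼ e × HasFPPOn P (Component P r)) → HasFPP Q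
  hasFPP disc fpp = Q-connected , no-removable-cover
    where
      no-removable-cover : ∀ e f → Cov Q Full e f → ¬ ConnectedOn (Remove Q e f) Full
      no-removable-cover e f cov conn with e ≟ᶠ c ×-dec f ≟ᶠ d | fpp e
      ... | yes (refl , refl) | _ = disc (bridge-removed⇒Connected conn)
      ... | no not-cd | r , r∼e , (_ , P-fpp) =
        P-fpp e f (Cov⁻ r∼e not-cd cov) (Remove-connected⁻ r e f conn)

connected-upperCover⇒Bridge : ∀ {m} {P Q : BRel m} →
                              IsPoset P → ¬ Connected P → UpperCover P Q → Connected Q → Bridge P Q
connected-upperCover⇒Bridge {m} {P} {Q} isP disc
                            cover@(isQ , (P⊑Q , c , d , c≤d , c≰d) , _) Q-conn =
  record
    { c = c ; d = d ; P⊑Q = P⊑Q ; c≤d = c≤d ; only-c≤d = only-c≤d ; c≁d = c≁d ; c∼⊎d∼ = c∼⊎d∼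
    ; c-minimal = c-minimal ; d-maximal = d-maximal }
  where
    Q⊑adjoin : Q ⊑ adjoin P c d
    Q⊑adjoin = upperCover-squeeze cover
      (adjoin-isPoset P c d isP (new-pair-not-reversed isP isQ P⊑Q c≤d c≰d))
      (⊏-adjoin P c d isP c≰d) (adjoin-least P c d isQ P⊑Q c≤d)

    Near : Fin m → Set
    Near x = P ⊢ c ∼ x ⊎ P ⊢ d ∼ x

    near-step : Near x → Comp (Le Q) Full x y → Near y
    near-step {x = x} {y = y} near (_ , _ , inj₁ x≤y) with adjoin⁻ P c d (Q⊑adjoin x y x≤y)
    ... | inj₁ x≤Py = Sum.map (_◅◅ ≤⇒∼ x≤Py) (_◅◅ ≤⇒∼ x≤Py) near
    ... | inj₂ (_ , d≤y) = inj₂ (≤⇒∼ d≤y)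
    near-step {x = x} {y = y} near (_ , _ , inj₂ y≤x) with adjoin⁻ P c d (Q⊑adjoin y x y≤x)
    ... | inj₁ y≤Px = Sum.map (_◅◅ ≥⇒∼ y≤Px) (_◅◅ ≥⇒∼ y≤Px) near
    ... | inj₂ (y≤c , _) = inj₁ (≥⇒∼ y≤c)

    near-path : Star (Comp (Le Q) Full) x y → Near x → Near y
    near-path ε = id
    near-path (edge ◅ path) = near-path path ∘ flip near-step edge

    c∼⊎d∼ : ∀ x → Near x
    c∼⊎d∼ x = near-path (Q-conn c x tt tt) (inj₁ ε)

    c≁d : ¬ P ⊢ c ∼ d
    c≁d c∼d = disc (∼-everywhere⇒Connected λ x → [ id , c∼d ◅◅_ ]′ (c∼⊎d∼ x))

    c-minimal : ∀ y → P ⊢ y ≤ c → y ≡ c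
    c-minimal = upperCover-minimal isP cover c≤d c≰d λ y y≤c y≤d → c≁d (≥⇒∼ y≤c ◅◅ ≤⇒∼ y≤d)

    d-maximal : ∀ y → P ⊢ d ≤ y → y ≡ d
    d-maximal = upperCover-minimal (dual-isPoset isP) (dual-upperCover cover) c≤d c≰d
                                   λ y d≤y c≤y → c≁d (≤⇒∼ c≤y ◅◅ ≥⇒∼ d≤y)

    only-c≤d : ∀ x y → Q ⊢ x ≤ y → P ⊢ x ≤ y ⊎ (x ≡ c × y ≡ d)
    only-c≤d x y x≤y = adjoin-only P c d c-minimal d-maximal (Q⊑adjoin x y x≤y)

¬UShielded⇒TwoComponentsFPP : ∀ {m} {P : BRel m} →
                              IsPoset P → ¬ Connected P → Fin m → ¬ UShielded P → TwoComponentsFPP P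
¬UShielded⇒TwoComponentsFPP {m} {P} isP disc a not-shielded =
  a , b , a≁b , a∼⊎b∼ , component-fpp a , component-fpp b
  where
    refute : (∀ {Q} → Bridge P Q → HasFPP Q → ⊥) → ⊥
    refute absurd = not-shielded λ Q cover fpp →
      absurd (connected-upperCover⇒Bridge isP disc cover (proj₁ fpp)) fpp

    b : Fin m
    b = proj₁ (separated-from disc a)

    a≁b : ¬ P ⊢ a ∼ b
    a≁b = proj₂ (separated-from disc a)

    a∼⊎b∼ : ∀ x → P ⊢ a ∼ x ⊎ P ⊢ b ∼ x
    a∼⊎b∼ x with P ⊢ a ∼? x | P ⊢ b ∼? x
    ... | yes a∼x | _ = inj₁ a∼x
    ... | no _ | yes b∼x = inj₂ b∼x
    ... | no a≁x | no b≁x =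
      ⊥-elim (refute λ B _ → no-three-components (Bridge.c∼⊎d∼ B) a≁b a≁x b≁x)

    component-fpp : ∀ r → HasFPPOn P (Component P r)
    component-fpp r = component-connected r , λ e f cov conn →
      refute λ B fpp → proj₂ (BridgeProperties.component-hasFPP B fpp r) e f cov conn

TwoComponentsFPP⇒¬UShielded : IsPoset P → ¬ Connected P → TwoComponentsFPP P → ¬ UShielded P
TwoComponentsFPP⇒¬UShielded {P = P} isP disc (a , b , a≁b , a∼⊎b∼ , a-fpp , b-fpp)
  with minimal-below isP a | minimal-below (dual-isPoset isP) b
... | c , c≤a , c-minimal | d , b≤d , d-maximal = λ shielded →
  shielded (adjoin P c d) (upperCover (adjoin-isPoset P c d isP d≰c)) (hasFPP disc component-fpp)
  where
    c≁d : ¬ P ⊢ c ∼ d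
    c≁d c∼d = a≁b (≥⇒∼ c≤a ◅◅ c∼d ◅◅ ≥⇒∼ b≤d)

    d≰c : ¬ P ⊢ d ≤ c
    d≰c = c≁d ∘ ≥⇒∼

    bridge : Bridge P (adjoin P c d)
    bridge = record
      { c = c ; d = d ; P⊑Q = ⊑-adjoin P c d ; c≤d = adjoin-c≤d P c d isP
      ; only-c≤d = λ _ _ → adjoin-only P c d c-minimal d-maximal ; c≁d = c≁d
      ; c∼⊎d∼ = λ x → Sum.map (≤⇒∼ c≤a ◅◅_) (≥⇒∼ b≤d ◅◅_) (a∼⊎b∼ x)
      ; c-minimal = c-minimal ; d-maximal = d-maximal }

    open BridgeProperties bridge using (upperCover; hasFPP)

    component-fpp : ∀ e → ∃ λ r → P ⊢ r ∼ e × HasFPPOn P (Component P r)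
    component-fpp e = [ (λ a∼e → a , a∼e , a-fpp) , (λ b∼e → b , b∼e , b-fpp) ]′ (a∼⊎b∼ e)

lemma4 : (n : ℕ) (P : BRel (suc n)) → IsPoset P → ¬ Connected P →
         ((¬ UShielded P) ⇔ TwoComponentsFPP P)
lemma4 n P isP disc =
  mk⇔ (¬UShielded⇒TwoComponentsFPP isP disc zero) (TwoComponentsFPP⇒¬UShielded isP disc)
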